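{- Let $G$ be a group and $H \leq A \leq G$. Then $A$ is a perfect code of $(G,H)$ if and only if there exists a right transversal $Y$ of $A$ in $G$ such that $Y^{ -1}H=HY$.
   Context: All groups are finite. For a group $G$, a subgroup $H\leq G$ and a subset $U\subseteq G$ which is a union of double cosets of $H$ with $H\cap U=\emptyset$ and $U^{ -1}=U$, the coset graph $\mathrm{Cos}(G,H,U)$ has as vertex set the set of left cosets of $H$ in $G$, with $g_1H$ and $g_2H$ adjacent iff $g_1^{ -1}g_2\in U$. A perfect code in a graph is an independent set $C$ of vertices such that every vertex outside $C$ is adjacent to exactly one vertex of $C$. For $H\leq A\leq G$, $A$ is called a perfect code of the pair $(G,H)$ if there is a coset graph $\mathrm{Cos}(G,H,U)$ in which the set $\{aH: a\in A\}$ of left cosets of $H$ contained in $A$ is a perfect code. -}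

module Defs where

open import Data.Nat using (ℕ)
open import Data.Fin using (Fin)
open import Data.Fin.Subset using (Subset; _∈_; _∉_; _⊆_)
open import Data.Product using (Σ; Σ-syntax; _×_; _,_)
open import Relation.Binary.PropositionalEquality using (_≡_)
open import Relation.Nullary using (¬_)
open import Function.Bundles using (_⇔_)
open import Algebra.Structures using (IsGroup)

-- A finite group of order n, presented on the carrier Fin n
-- (every finite group is isomorphic to one of this form).
record FinGroup (n : ℕ) : Set where
  infixl 7 _∙_
  infix 8 _⁻¹
  field
    _∙_     : Fin n → Fin n → Fin n
    ε       : Fin n
    _⁻¹     : Fin n → Fin n
    isGroup : IsGroup _≡_ _∙_ ε _⁻¹

module _ {n : ℕ} (G : FinGroup n) where
  open FinGroup G

  IsSubgroup : Subset n → Set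
  IsSubgroup H =
    (ε ∈ H) ×
    (∀ {x y} → x ∈ H → y ∈ H → x ∙ y ∈ H) ×
    (∀ {x} → x ∈ H → x ⁻¹ ∈ H)

  IsConnectionSet : Subset n → Subset n → Set
  IsConnectionSet H U =
    (∀ {h k u} → h ∈ H → k ∈ H → u ∈ U → h ∙ u ∙ k ∈ U) ×
    (∀ {x} → x ∈ H → x ∉ U) ×
    (∀ {u} → u ∈ U → u ⁻¹ ∈ U)

  -- Vertices of Cos(G,H,U) are left cosets gH, represented by g.
  -- g₁H = g₂H  iff  g₁⁻¹ g₂ ∈ H.
  SameCoset : Subset n → Fin n → Fin n → Set
  SameCoset H g₁ g₂ = g₁ ⁻¹ ∙ g₂ ∈ H

  Adjacent : Subset n → Fin n → Fin n → Set
  Adjacent U g₁ g₂ = g₁ ⁻¹ ∙ g₂ ∈ U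

  CosetIn : Subset n → Subset n → Fin n → Set
  CosetIn H A g = Σ[ a ∈ Fin n ] (a ∈ A × SameCoset H g a)

  IsPerfectCodeIn : Subset n → Subset n → Subset n → Set
  IsPerfectCodeIn H U A =
    (∀ {x y} → CosetIn H A x → CosetIn H A y → ¬ Adjacent U x y) ×
    (∀ {g} → ¬ CosetIn H A g →
       Σ[ c ∈ Fin n ] (CosetIn H A c × Adjacent U g c ×
         (∀ {c'} → CosetIn H A c' → Adjacent U g c' → SameCoset H c c')))

  IsPerfectCodeOfPair : Subset n → Subset n → Set
  IsPerfectCodeOfPair H A =
    Σ[ U ∈ Subset n ] (IsConnectionSet H U × IsPerfectCodeIn H U A)

  -- Y is a right transversal of A in G: exactly one element of Y in each
  -- right coset Ag  (Ay = Ag iff g y⁻¹ ∈ A).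
  IsRightTransversal : Subset n → Subset n → Set
  IsRightTransversal A Y =
    (∀ g → Σ[ y ∈ Fin n ] (y ∈ Y × g ∙ y ⁻¹ ∈ A)) ×
    (∀ {y y'} → y ∈ Y → y' ∈ Y → y ∙ y' ⁻¹ ∈ A → y ≡ y')

  InvProdEq : Subset n → Subset n → Set
  InvProdEq Y H = ∀ x →
    (Σ[ y ∈ Fin n ] Σ[ h ∈ Fin n ] (y ∈ Y × h ∈ H × x ≡ y ⁻¹ ∙ h)) ⇔
    (Σ[ h ∈ Fin n ] Σ[ y ∈ Fin n ] (h ∈ H × y ∈ Y × x ≡ h ∙ y))

-- For the forward direction, put Y := one element of U ∪ {1} in each right
-- coset of A. A vertex outside the code has exactly one code-neighbour coset,
-- which forces U ∩ Ag to be a single right H-coset Hu for Ag ≠ A, and U ∩ A = ∅;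
-- hence HY = H ∪ U, which is closed under inversion, so Y⁻¹H = (HY)⁻¹ = HY.
-- Conversely, for a transversal Y with Y⁻¹H = HY the set U := Y⁻¹H ∖ A is a
-- connection set, and the unique codeword adjacent to gH (g ∉ A) is g y⁻¹ H,
-- where y is the element of Y in Ag.
module Submission where

open import Defs
open import Data.Nat using (ℕ)
open import Data.Fin using (Fin; _<_)
open import Data.Fin.Properties using (any?; _≟_; _<?_; <-cmp)
open import Data.Fin.Induction using (<-wellFounded)
open import Data.Fin.Subset using (Subset; _⊆_; _∈_; _∉_)
open import Data.Fin.Subset.Properties using (_∈?_)
open import Data.Vec using (tabulate)
open import Data.Vec.Properties using (lookup∘tabulate; []=⇒lookup; lookup⇒[]=)
open import Data.Product using (Σ-syntax; ∃-syntax; _×_; _,_; proj₁; proj₂)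
open import Data.Sum using (_⊎_; inj₁; inj₂)
import Data.Sum as Sum
open import Level using (0ℓ)
open import Relation.Nullary using (¬_; yes; no; does; contradiction)
open import Relation.Nullary.Decidable using (_×-dec_; _⊎-dec_; ¬?; dec-true)
open import Relation.Unary using (Pred; Decidable)
open import Relation.Binary using (Rel; IsEquivalence; tri<; tri≈; tri>)
import Relation.Binary as B
open import Relation.Binary.PropositionalEquality
  using (_≡_; refl; sym; trans; cong; subst; module ≡-Reasoning)
open import Induction.WellFounded using (Acc; acc)
open import Function.Base using (_∘_)
open import Function.Bundles using (_⇔_; mk⇔; Equivalence)
import Function.Properties.Equivalence as ⇔
open import Algebra.Structures using (IsGroup)
open import Algebra.Bundles using (Group)
import Algebra.Properties.Group as GroupProperties

module _ {n : ℕ} {P : Pred (Fin n) 0ℓ} (P? : Decidable P) where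

  toSubset : Subset n
  toSubset = tabulate (λ x → does (P? x))

  ∈-toSubset⁺ : ∀ {x} → P x → x ∈ toSubset
  ∈-toSubset⁺ {x} px =
    lookup⇒[]= x toSubset (trans (lookup∘tabulate _ x) (dec-true (P? x) px))

  ∈-toSubset⁻ : ∀ {x} → x ∈ toSubset → P x
  ∈-toSubset⁻ {x} x∈
    with P? x | trans (sym (lookup∘tabulate (λ x → does (P? x)) x)) ([]=⇒lookup x∈)
  ... | yes px | _ = px
  ... | no _   | ()

  leastWitness : ∀ {u} → P u → ∃[ y ] (P y × ∀ {z} → z < y → ¬ P z)
  leastWitness {u} = search (<-wellFounded u)
    where
    search : ∀ {u} → Acc _<_ u → P u → ∃[ y ] (P y × ∀ {z} → z < y → ¬ P z)
    search {u} (acc smaller) pu with any? (λ z → (z <? u) ×-dec P? z)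
    ... | yes (z , z<u , pz) = search (smaller z<u) pz
    ... | no ∄z              = u , pu , λ z<u pz → ∄z (_ , z<u , pz)

module CanonicalTransversal
  {n : ℕ} {_∼_ : Rel (Fin n) 0ℓ} (∼-isEquivalence : IsEquivalence _∼_)
  (_∼?_ : B.Decidable _∼_) {V : Pred (Fin n) 0ℓ} (V? : Decidable V) where

  open IsEquivalence ∼-isEquivalence using () renaming (sym to ∼-sym; trans to ∼-trans)

  IsLeastInClass : Pred (Fin n) 0ℓ
  IsLeastInClass y = V y × ¬ (∃[ z ] (z < y × V z × z ∼ y))

  isLeastInClass? : Decidable IsLeastInClass
  isLeastInClass? y = V? y ×-dec ¬? (any? (λ z → (z <? y) ×-dec V? z ×-dec (z ∼? y)))

  transversal : Subset n
  transversal = toSubset isLeastInClass?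

  transversal⊆V : ∀ {y} → y ∈ transversal → V y
  transversal⊆V y∈ with ∈-toSubset⁻ isLeastInClass? y∈
  ... | Vy , _ = Vy

  transversal-unique : ∀ {y y'} → y ∈ transversal → y' ∈ transversal → y ∼ y' → y ≡ y'
  transversal-unique {y} {y'} y∈ y'∈ y∼y'
    with ∈-toSubset⁻ isLeastInClass? y∈ | ∈-toSubset⁻ isLeastInClass? y'∈ | <-cmp y y'
  ... | Vy , _  | _ , ∄'  | tri< y<y' _ _ = contradiction (y , y<y' , Vy , y∼y') ∄'
  ... | _       | _       | tri≈ _ y≡y' _ = y≡y'
  ... | _ , ∄   | Vy' , _ | tri> _ _ y'<y = contradiction (y' , y'<y , Vy' , ∼-sym y∼y') ∄

  transversal-covers : (∀ g → ∃[ v ] (V v × g ∼ v)) → ∀ g → ∃[ y ] (y ∈ transversal × g ∼ y)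
  transversal-covers V-meets g with V-meets g
  ... | v , Vv , g∼v with leastWitness (λ y → V? y ×-dec (g ∼? y)) (Vv , g∼v)
  ... | y , (Vy , g∼y) , least =
    y , ∈-toSubset⁺ isLeastInClass? (Vy , λ (z , z<y , Vz , z∼y) →
                                             least z<y (Vz , ∼-trans g∼y (∼-sym z∼y))) ,
    g∼y

module _ {n : ℕ} (G : FinGroup n) where

  open FinGroup G
  open IsGroup isGroup using (assoc; identityˡ; identityʳ; inverseˡ; inverseʳ)
  private
    group : Group 0ℓ 0ℓ
    group = record { isGroup = isGroup }

  open GroupProperties group
    using (⁻¹-involutive; ⁻¹-anti-homo-∙; ε⁻¹≈ε;
           \\-leftDividesˡ; \\-leftDividesʳ; //-rightDividesˡ; //-rightDividesʳ)

  SameRightCoset : Subset n → Rel (Fin n) 0ℓ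
  SameRightCoset K x y = x ∙ y ⁻¹ ∈ K

  _·_ : Subset n → Subset n → Pred (Fin n) 0ℓ
  (H · Y) x = Σ[ h ∈ Fin n ] Σ[ y ∈ Fin n ] (h ∈ H × y ∈ Y × x ≡ h ∙ y)

  _⁻¹·_ : Subset n → Subset n → Pred (Fin n) 0ℓ
  (Y ⁻¹· H) x = Σ[ y ∈ Fin n ] Σ[ h ∈ Fin n ] (y ∈ Y × h ∈ H × x ≡ y ⁻¹ ∙ h)

  ⁻¹·-dec : ∀ Y H → Decidable (Y ⁻¹· H)
  ⁻¹·-dec Y H x =
    any? (λ y → any? (λ h → (y ∈? Y) ×-dec (h ∈? H) ×-dec (x ≟ y ⁻¹ ∙ h)))

  ε⁻¹∙-identity : ∀ x → ε ⁻¹ ∙ x ≡ x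
  ε⁻¹∙-identity x = trans (cong (_∙ x) ε⁻¹≈ε) (identityˡ x)

  ⁻¹-anti-homo-⁻¹∙ : ∀ x y → (x ⁻¹ ∙ y) ⁻¹ ≡ y ⁻¹ ∙ x
  ⁻¹-anti-homo-⁻¹∙ x y = trans (⁻¹-anti-homo-∙ (x ⁻¹) y) (cong (y ⁻¹ ∙_) (⁻¹-involutive x))

  module Subgroup {K : Subset n} (K≤G : IsSubgroup G K) where

    ε∈ : ε ∈ K
    ε∈ = proj₁ K≤G

    ∙∈ : ∀ {x y} → x ∈ K → y ∈ K → x ∙ y ∈ K
    ∙∈ = proj₁ (proj₂ K≤G)

    ⁻¹∈ : ∀ {x} → x ∈ K → x ⁻¹ ∈ K
    ⁻¹∈ = proj₂ (proj₂ K≤G)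

    ⁻¹∈⁻ : ∀ {x} → x ⁻¹ ∈ K → x ∈ K
    ⁻¹∈⁻ {x} x⁻¹∈ = subst (_∈ K) (⁻¹-involutive x) (⁻¹∈ x⁻¹∈)

    \\∈ : ∀ {x y} → x ∈ K → y ∈ K → x ⁻¹ ∙ y ∈ K
    \\∈ x∈ y∈ = ∙∈ (⁻¹∈ x∈) y∈

    ∙∈⇒∈ˡ : ∀ {x y} → x ∙ y ∈ K → y ∈ K → x ∈ K
    ∙∈⇒∈ˡ {x} {y} xy∈ y∈ = subst (_∈ K) (//-rightDividesʳ y x) (∙∈ xy∈ (⁻¹∈ y∈))

    ∙∈⇒∈ʳ : ∀ {x y} → x ∙ y ∈ K → x ∈ K → y ∈ K
    ∙∈⇒∈ʳ {x} {y} xy∈ x∈ = subst (_∈ K) (\\-leftDividesʳ x y) (\\∈ x∈ xy∈)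

    sameRightCoset-isEquivalence : IsEquivalence (SameRightCoset K)
    sameRightCoset-isEquivalence = record
      { refl  = λ {x} → subst (_∈ K) (sym (inverseʳ x)) ε∈
      ; sym   = λ {x} {y} xy⁻¹∈ →
          subst (_∈ K) (trans (⁻¹-anti-homo-∙ x (y ⁻¹)) (cong (_∙ x ⁻¹) (⁻¹-involutive y)))
                (⁻¹∈ xy⁻¹∈)
      ; trans = λ {x} {y} {z} xy⁻¹∈ yz⁻¹∈ →
          subst (_∈ K) (trans (sym (assoc (x ∙ y ⁻¹) y (z ⁻¹)))
                              (cong (_∙ z ⁻¹) (//-rightDividesˡ y x)))
                (∙∈ xy⁻¹∈ yz⁻¹∈)
      }

    sameRightCoset-dec : B.Decidable (SameRightCoset K)
    sameRightCoset-dec x y = (x ∙ y ⁻¹) ∈? K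

    ⁻¹·⇔·⁻¹ : ∀ {Y x} → (Y ⁻¹· K) x ⇔ (K · Y) (x ⁻¹)
    ⁻¹·⇔·⁻¹ {Y} {x} = mk⇔
      (λ (y , h , y∈ , h∈ , x≡) →
        h ⁻¹ , y , ⁻¹∈ h∈ , y∈ , trans (cong _⁻¹ x≡) (⁻¹-anti-homo-⁻¹∙ y h))
      (λ (h , y , h∈ , y∈ , x⁻¹≡) →
        y , h ⁻¹ , y∈ , ⁻¹∈ h∈ ,
        trans (sym (⁻¹-involutive x)) (trans (cong _⁻¹ x⁻¹≡) (⁻¹-anti-homo-∙ h y)))

  module _ {H A : Subset n} (H≤G : IsSubgroup G H) (A≤G : IsSubgroup G A) (H⊆A : H ⊆ A) where

    private
      module H = Subgroup H≤G
      module A = Subgroup A≤G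

    cosetIn⇒∈ : ∀ {g} → CosetIn G H A g → g ∈ A
    cosetIn⇒∈ (a , a∈A , g⁻¹a∈H) = A.⁻¹∈⁻ (A.∙∈⇒∈ˡ (H⊆A g⁻¹a∈H) a∈A)

    ∈⇒cosetIn : ∀ {g} → g ∈ A → CosetIn G H A g
    ∈⇒cosetIn {g} g∈A = g , g∈A , subst (_∈ H) (sym (inverseˡ g)) H.ε∈

    module PerfectCode⇒Transversal
      {U : Subset n} (U-connection : IsConnectionSet G H U) (U-code : IsPerfectCodeIn G H U A) where

      open CanonicalTransversal {_∼_ = SameRightCoset A} A.sameRightCoset-isEquivalence
        A.sameRightCoset-dec {V = λ x → x ∈ U ⊎ x ≡ ε} (λ x → (x ∈? U) ⊎-dec (x ≟ ε))
        using (transversal; transversal⊆V; transversal-unique; transversal-covers)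
      open IsEquivalence A.sameRightCoset-isEquivalence using () renaming (sym to ∼-sym)

      Y : Subset n
      Y = transversal

      U-biinvariant : ∀ {h k u} → h ∈ H → k ∈ H → u ∈ U → h ∙ u ∙ k ∈ U
      U-biinvariant = proj₁ U-connection

      U-symmetric : ∀ {u} → u ∈ U → u ⁻¹ ∈ U
      U-symmetric = proj₂ (proj₂ U-connection)

      U∩A≡∅ : ∀ {u} → u ∈ U → u ∉ A
      U∩A≡∅ {u} u∈U u∈A =
        proj₁ U-code (∈⇒cosetIn A.ε∈) (∈⇒cosetIn u∈A)
          (subst (_∈ U) (sym (ε⁻¹∙-identity u)) u∈U)

      codeNeighbours-sameCoset : ∀ {g a b} → g ∉ A → a ∈ A → b ∈ A →
        Adjacent G U g a → Adjacent G U g b → a ⁻¹ ∙ b ∈ H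
      codeNeighbours-sameCoset {g} {a} {b} g∉A a∈A b∈A g∼a g∼b
        with c , _ , _ , unique ← proj₂ U-code (g∉A ∘ cosetIn⇒∈) =
        subst (_∈ H) c⁻¹a\\c⁻¹b≡a⁻¹b
          (H.\\∈ (unique (∈⇒cosetIn a∈A) g∼a) (unique (∈⇒cosetIn b∈A) g∼b))
        where
        open ≡-Reasoning
        c⁻¹a\\c⁻¹b≡a⁻¹b : (c ⁻¹ ∙ a) ⁻¹ ∙ (c ⁻¹ ∙ b) ≡ a ⁻¹ ∙ b
        c⁻¹a\\c⁻¹b≡a⁻¹b = begin
          (c ⁻¹ ∙ a) ⁻¹ ∙ (c ⁻¹ ∙ b) ≡⟨ cong (_∙ (c ⁻¹ ∙ b)) (⁻¹-anti-homo-⁻¹∙ c a) ⟩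
          (a ⁻¹ ∙ c) ∙ (c ⁻¹ ∙ b)    ≡⟨ assoc (a ⁻¹) c (c ⁻¹ ∙ b) ⟩
          a ⁻¹ ∙ (c ∙ (c ⁻¹ ∙ b))    ≡⟨ cong (a ⁻¹ ∙_) (\\-leftDividesˡ c b) ⟩
          a ⁻¹ ∙ b                   ∎

      U∩Ag-sameRightCoset : ∀ {u₁ u₂} → u₁ ∈ U → u₂ ∈ U → u₁ ∙ u₂ ⁻¹ ∈ A → u₁ ∙ u₂ ⁻¹ ∈ H
      U∩Ag-sameRightCoset {u₁} {u₂} u₁∈U u₂∈U u₁u₂⁻¹∈A =
        subst (_∈ H) (ε⁻¹∙-identity (u₁ ∙ u₂ ⁻¹))
          (codeNeighbours-sameCoset (U∩A≡∅ u₁∈U) A.ε∈ u₁u₂⁻¹∈A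
            (subst (_∈ U) (sym (identityʳ (u₁ ⁻¹))) (U-symmetric u₁∈U))
            (subst (_∈ U) (sym (\\-leftDividesʳ u₁ (u₂ ⁻¹))) (U-symmetric u₂∈U)))

      -- For g ∉ A, the codeword c adjacent to gH gives c⁻¹g ∈ U ∩ Ag.
      U∪ε-meets-every-coset : ∀ g → ∃[ v ] ((v ∈ U ⊎ v ≡ ε) × g ∙ v ⁻¹ ∈ A)
      U∪ε-meets-every-coset g with g ∈? A
      ... | yes g∈A = ε , inj₂ refl , A.∙∈ g∈A (A.⁻¹∈ A.ε∈)
      ... | no g∉A
        with c , c∈ , g⁻¹c∈U , _ ← proj₂ U-code (g∉A ∘ cosetIn⇒∈) =
        (g ⁻¹ ∙ c) ⁻¹ , inj₁ (U-symmetric g⁻¹c∈U) ,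
        subst (_∈ A) (sym (trans (cong (g ∙_) (⁻¹-involutive (g ⁻¹ ∙ c))) (\\-leftDividesˡ g c)))
          (cosetIn⇒∈ c∈)

      Y-isRightTransversal : IsRightTransversal G A Y
      Y-isRightTransversal = transversal-covers U∪ε-meets-every-coset , transversal-unique

      ε∈Y : ε ∈ Y
      ε∈Y with y , y∈Y , εy⁻¹∈A ← transversal-covers U∪ε-meets-every-coset ε
        with transversal⊆V y∈Y
      ... | inj₂ refl = y∈Y
      ... | inj₁ y∈U = contradiction (A.∙∈⇒∈ˡ (∼-sym εy⁻¹∈A) (A.⁻¹∈ A.ε∈)) (U∩A≡∅ y∈U)

      H·Y⇔H∪U : ∀ {x} → (H · Y) x ⇔ (x ∈ H ⊎ x ∈ U)
      H·Y⇔H∪U = mk⇔ H·Y⊆H∪U H∪U⊆H·Y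
        where
        H·Y⊆H∪U : ∀ {x} → (H · Y) x → x ∈ H ⊎ x ∈ U
        H·Y⊆H∪U (h , y , h∈H , y∈Y , refl) with transversal⊆V y∈Y
        ... | inj₁ y∈U = inj₂ (subst (_∈ U) (identityʳ (h ∙ y)) (U-biinvariant h∈H H.ε∈ y∈U))
        ... | inj₂ refl = inj₁ (subst (_∈ H) (sym (identityʳ h)) h∈H)

        H∪U⊆H·Y : ∀ {x} → x ∈ H ⊎ x ∈ U → (H · Y) x
        H∪U⊆H·Y {x} (inj₁ x∈H) = x , ε , x∈H , ε∈Y , sym (identityʳ x)
        H∪U⊆H·Y {x} (inj₂ x∈U)
          with y , y∈Y , xy⁻¹∈A ← transversal-covers U∪ε-meets-every-coset x
          with transversal⊆V y∈Y
        ... | inj₁ y∈U =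
          x ∙ y ⁻¹ , y , U∩Ag-sameRightCoset x∈U y∈U xy⁻¹∈A , y∈Y , sym (//-rightDividesˡ y x)
        ... | inj₂ refl = contradiction (A.∙∈⇒∈ˡ xy⁻¹∈A (A.⁻¹∈ A.ε∈)) (U∩A≡∅ x∈U)

      H∪U-⁻¹-closed : ∀ {x} → x ∈ H ⊎ x ∈ U → x ⁻¹ ∈ H ⊎ x ⁻¹ ∈ U
      H∪U-⁻¹-closed = Sum.map H.⁻¹∈ U-symmetric

      Y⁻¹·H≡H·Y : InvProdEq G Y H
      Y⁻¹·H≡H·Y x =
        ⇔.trans H.⁻¹·⇔·⁻¹ (⇔.trans H·Y⇔H∪U (⇔.trans H∪U⁻¹⇔H∪U (⇔.sym H·Y⇔H∪U)))
        where
        H∪U⁻¹⇔H∪U : (x ⁻¹ ∈ H ⊎ x ⁻¹ ∈ U) ⇔ (x ∈ H ⊎ x ∈ U)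
        H∪U⁻¹⇔H∪U = mk⇔
          (subst (λ z → z ∈ H ⊎ z ∈ U) (⁻¹-involutive x) ∘ H∪U-⁻¹-closed)
          H∪U-⁻¹-closed

    module Transversal⇒PerfectCode
      {Y : Subset n} (Y-transversal : IsRightTransversal G A Y) (Y⁻¹·H≡H·Y : InvProdEq G Y H) where

      open IsEquivalence A.sameRightCoset-isEquivalence using () renaming (trans to ∼-trans)

      Y⁻¹·H∖A? : Decidable (λ x → (Y ⁻¹· H) x × x ∉ A)
      Y⁻¹·H∖A? x = ⁻¹·-dec Y H x ×-dec ¬? (x ∈? A)

      U : Subset n
      U = toSubset Y⁻¹·H∖A?

      ∈U⁺ : ∀ {x} → (Y ⁻¹· H) x → x ∉ A → x ∈ U
      ∈U⁺ x∈Y⁻¹H x∉A = ∈-toSubset⁺ Y⁻¹·H∖A? (x∈Y⁻¹H , x∉A)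

      ∈U⁻ : ∀ {x} → x ∈ U → (Y ⁻¹· H) x × x ∉ A
      ∈U⁻ = ∈-toSubset⁻ Y⁻¹·H∖A?

      Y⁻¹·H-∙ʳ : ∀ {x k} → (Y ⁻¹· H) x → k ∈ H → (Y ⁻¹· H) (x ∙ k)
      Y⁻¹·H-∙ʳ {k = k} (y , h , y∈Y , h∈H , refl) k∈H =
        y , h ∙ k , y∈Y , H.∙∈ h∈H k∈H , assoc (y ⁻¹) h k

      H·Y-∙ˡ : ∀ {h x} → h ∈ H → (H · Y) x → (H · Y) (h ∙ x)
      H·Y-∙ˡ {h} h∈H (h' , y , h'∈H , y∈Y , refl) =
        h ∙ h' , y , H.∙∈ h∈H h'∈H , y∈Y , sym (assoc h h' y)

      Y⁻¹·H-∙ˡ : ∀ {h x} → h ∈ H → (Y ⁻¹· H) x → (Y ⁻¹· H) (h ∙ x)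
      Y⁻¹·H-∙ˡ {h} {x} h∈H =
        Equivalence.from (Y⁻¹·H≡H·Y (h ∙ x)) ∘ H·Y-∙ˡ h∈H ∘ Equivalence.to (Y⁻¹·H≡H·Y x)

      Y⁻¹·H-⁻¹ : ∀ {x} → (Y ⁻¹· H) x → (Y ⁻¹· H) (x ⁻¹)
      Y⁻¹·H-⁻¹ {x} = Equivalence.from (Y⁻¹·H≡H·Y (x ⁻¹)) ∘ Equivalence.to H.⁻¹·⇔·⁻¹

      U-isConnectionSet : IsConnectionSet G H U
      U-isConnectionSet = biinvariant , (λ x∈H x∈U → proj₂ (∈U⁻ x∈U) (H⊆A x∈H)) , symmetric
        where
        biinvariant : ∀ {h k u} → h ∈ H → k ∈ H → u ∈ U → h ∙ u ∙ k ∈ U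
        biinvariant h∈H k∈H u∈U with u∈Y⁻¹H , u∉A ← ∈U⁻ u∈U =
          ∈U⁺ (Y⁻¹·H-∙ʳ (Y⁻¹·H-∙ˡ h∈H u∈Y⁻¹H) k∈H)
              (λ huk∈A → u∉A (A.∙∈⇒∈ʳ (A.∙∈⇒∈ˡ huk∈A (H⊆A k∈H)) (H⊆A h∈H)))

        symmetric : ∀ {u} → u ∈ U → u ⁻¹ ∈ U
        symmetric u∈U with u∈Y⁻¹H , u∉A ← ∈U⁻ u∈U = ∈U⁺ (Y⁻¹·H-⁻¹ u∈Y⁻¹H) (u∉A ∘ A.⁻¹∈⁻)

      dominating : ∀ {g} → g ∉ A →
        Σ[ c ∈ Fin n ] (c ∈ A × Adjacent G U g c ×
          (∀ {c'} → c' ∈ A → Adjacent G U g c' → SameCoset G H c c'))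
      dominating {g} g∉A with y , y∈Y , gy⁻¹∈A ← proj₁ Y-transversal g =
        g ∙ y ⁻¹ , gy⁻¹∈A , g∼gy⁻¹ , unique
        where
        open ≡-Reasoning

        g∼gy⁻¹ : g ⁻¹ ∙ (g ∙ y ⁻¹) ∈ U
        g∼gy⁻¹ = subst (_∈ U) (sym (\\-leftDividesʳ g (y ⁻¹)))
          (∈U⁺ (y , ε , y∈Y , H.ε∈ , sym (identityʳ (y ⁻¹)))
               (λ y⁻¹∈A → g∉A (A.∙∈⇒∈ˡ gy⁻¹∈A y⁻¹∈A)))

        unique : ∀ {c'} → c' ∈ A → g ⁻¹ ∙ c' ∈ U → (g ∙ y ⁻¹) ⁻¹ ∙ c' ∈ H
        unique {c'} c'∈A g⁻¹c'∈U
          with (y' , h , y'∈Y , h∈H , g⁻¹c'≡y'⁻¹h) , _ ← ∈U⁻ g⁻¹c'∈U =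
          subst (_∈ H) (sym c⁻¹c'≡h) h∈H
          where
          y'g⁻¹c'≡h : y' ∙ (g ⁻¹ ∙ c') ≡ h
          y'g⁻¹c'≡h = trans (cong (y' ∙_) g⁻¹c'≡y'⁻¹h) (\\-leftDividesˡ y' h)

          y'∼g : y' ∙ g ⁻¹ ∈ A
          y'∼g = A.∙∈⇒∈ˡ (subst (_∈ A) (trans (sym y'g⁻¹c'≡h) (sym (assoc y' (g ⁻¹) c')))
                                        (H⊆A h∈H))
                         c'∈A

          y'≡y : y' ≡ y
          y'≡y = proj₂ Y-transversal y'∈Y y∈Y (∼-trans y'∼g gy⁻¹∈A)

          c⁻¹c'≡h : (g ∙ y ⁻¹) ⁻¹ ∙ c' ≡ h
          c⁻¹c'≡h = begin
            (g ∙ y ⁻¹) ⁻¹ ∙ c'    ≡⟨ cong (_∙ c') (⁻¹-anti-homo-∙ g (y ⁻¹)) ⟩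
            (y ⁻¹ ⁻¹ ∙ g ⁻¹) ∙ c' ≡⟨ cong (λ z → (z ∙ g ⁻¹) ∙ c') (⁻¹-involutive y) ⟩
            (y ∙ g ⁻¹) ∙ c'       ≡⟨ assoc y (g ⁻¹) c' ⟩
            y ∙ (g ⁻¹ ∙ c')       ≡⟨ cong (λ z → z ∙ (g ⁻¹ ∙ c')) (sym y'≡y) ⟩
            y' ∙ (g ⁻¹ ∙ c')      ≡⟨ y'g⁻¹c'≡h ⟩
            h                     ∎

      A-isPerfectCode : IsPerfectCodeIn G H U A
      A-isPerfectCode =
        (λ x∈A y∈A x∼y → proj₂ (∈U⁻ x∼y) (A.\\∈ (cosetIn⇒∈ x∈A) (cosetIn⇒∈ y∈A))) ,
        λ g∉A → let c , c∈A , g∼c , unique = dominating (g∉A ∘ ∈⇒cosetIn) in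
          c , ∈⇒cosetIn c∈A , g∼c , unique ∘ cosetIn⇒∈

theorem3p2 : ∀ {n : ℕ} (G : FinGroup n) (H A : Subset n) →
    IsSubgroup G H → IsSubgroup G A → H ⊆ A →
    (IsPerfectCodeOfPair G H A ⇔
      (Σ[ Y ∈ Subset n ] (IsRightTransversal G A Y × InvProdEq G Y H)))
theorem3p2 G H A H≤G A≤G H⊆A = mk⇔
  (λ (U , U-connection , U-code) →
    let open PerfectCode⇒Transversal G H≤G A≤G H⊆A U-connection U-code
    in Y , Y-isRightTransversal , Y⁻¹·H≡H·Y)
  (λ (Y , Y-transversal , Y⁻¹·H≡H·Y) →
    let open Transversal⇒PerfectCode G H≤G A≤G H⊆A Y-transversal Y⁻¹·H≡H·Y
    in U , U-isConnectionSet , A-isPerfectCode)
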